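{- Let $k\ge 1$, let $G$ be a simple graph, and let $uv\in E(G)$. Suppose $N(v)$ contains the vertex sets of two vertex-disjoint induced subgraphs $H_1,H_2$ of $G$, each isomorphic to a graph $H$ with $\chi_{CF}(H)=k$, such that there are no edges between $H_1$ and $H_2$ and no vertex of $H_1\cup H_2$ is adjacent to any vertex of $G$ other than $v$ and vertices of its own copy. Then every conflict-free $k$-coloring of $G$ colors $v$. If moreover the same hypothesis holds for $u$ (with two further such copies of $H$ attached to $u$), and $N(u)\cap N(v)$ contains the vertex sets of two vertex-disjoint induced subgraphs $J_1,J_2$, each isomorphic to a graph $J$ with $\chi_{CF}(J)=k-1$, with no edges between $J_1$ and $J_2$ and with no vertex of $J_1\cup J_2$ adjacent to any vertex other than $u$, $v$ and vertices of its own copy, then every conflict-free $k$-coloring of $G$ colors $u$ and $v$ with different colors.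
   Context: For a vertex $v$ of a simple graph $G$, $N(v)$ is its set of neighbors and $N[v]=N(v)\cup\{v\}$. A conflict-free $k$-coloring of $G$ is a map $\chi: V'\to\{1,\dots,k\}$ defined on a subset $V'\subseteq V(G)$ (other vertices uncolored) such that for every $v\in V(G)$ there is $w\in N[v]\cap V'$ whose color is different from the colors of all other vertices in $N[v]\cap V'$. $\chi_{CF}(G)$ denotes the least $k$ for which $G$ has a conflict-free $k$-coloring. -}

module Defs where

open import Data.Nat using (ℕ; _≤_)
open import Data.Fin using (Fin)
open import Data.Maybe using (Maybe; just; nothing)
open import Data.Product using (Σ; ∃; _×_; _,_)
open import Data.Sum using (_⊎_)
open import Relation.Nullary using (¬_)
open import Relation.Binary.PropositionalEquality using (_≡_; _≢_)

record Graph (n : ℕ) : Set₁ where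
  field
    Adj    : Fin n → Fin n → Set
    sym    : ∀ {x y} → Adj x y → Adj y x
    irrefl : ∀ x → ¬ Adj x x
open Graph public

_∈N[_]_ : ∀ {n} → Fin n → Graph n → Fin n → Set
w ∈N[ G ] v = (w ≡ v) ⊎ Adj G v w

-- A partial k-colouring: nothing = uncoloured.
Colouring : ℕ → ℕ → Set
Colouring n k = Fin n → Maybe (Fin k)

ConflictFree : ∀ {n} (G : Graph n) (k : ℕ) → Colouring n k → Set
ConflictFree G k χ =
  ∀ v → Σ _ λ w → (w ∈N[ G ] v) × Σ _ λ c → (χ w ≡ just c) ×
    (∀ w' → w' ∈N[ G ] v → w' ≢ w → χ w' ≢ just c)

HasCF : ∀ {n} → Graph n → ℕ → Set
HasCF {n} G k = Σ (Colouring n k) (ConflictFree G k)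

χCF≡ : ∀ {n} → Graph n → ℕ → Set
χCF≡ G k = HasCF G k × (∀ m → HasCF G m → k ≤ m)

InducedCopy : ∀ {n m} → Graph n → Graph m → (Fin m → Fin n) → Set
InducedCopy G H f =
  (∀ a b → f a ≡ f b → a ≡ b) ×
  (∀ a b → (Adj H a b → Adj G (f a) (f b)) × (Adj G (f a) (f b) → Adj H a b))

Attached : ∀ {n m} (G : Graph n) (H : Graph m)
           (Inside Outside : Fin n → Set) (f₁ f₂ : Fin m → Fin n) → Set
Attached G H Inside Outside f₁ f₂ =
  InducedCopy G H f₁ × InducedCopy G H f₂ ×
  (∀ a → Inside (f₁ a)) × (∀ a → Inside (f₂ a)) ×
  (∀ a b → f₁ a ≢ f₂ b) ×
  (∀ a b → ¬ Adj G (f₁ a) (f₂ b)) ×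
  (∀ a w → Adj G (f₁ a) w → Outside w ⊎ ∃ λ b → w ≡ f₁ b) ×
  (∀ a w → Adj G (f₂ a) w → Outside w ⊎ ∃ λ b → w ≡ f₂ b)

-- If v were uncoloured, each copy of H would be conflict-free coloured by the restriction of χ
-- (its unique colours cannot sit on v), so each copy uses all k colours; then every colour
-- occurs twice in N(v) and v has no unique colour. If u and v both had colour c, the unique
-- colours seen by the copies of J could be neither u, v nor c, so deleting c leaves a
-- conflict-free (k−1)-colouring of J; each copy then uses every colour other than c, and
-- together with u and v this again makes every colour occur twice in N[v].
module Submission where

open import Defs
open import Data.Nat using (ℕ; suc; zero; _≤_; _∸_)
open import Data.Nat.Properties using (n≮n)
open import Data.Fin using (Fin; _≟_; punchOut)
open import Data.Fin.Properties using (punchOut-cong; punchOut-injective; any?)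
open import Data.Maybe using (Maybe; just; nothing)
open import Data.Maybe.Properties using (just-injective) renaming (≡-dec to ≡-decMaybe)
open import Data.Product using (Σ; ∃; ∃₂; _×_; _,_; proj₁; proj₂)
open import Data.Sum using (_⊎_; inj₁; inj₂)
open import Data.Unit using (⊤; tt)
open import Data.Empty using (⊥-elim)
open import Function using (_∘_; id; case_of_)
open import Relation.Nullary using (¬_; yes; no)
open import Relation.Binary.PropositionalEquality as ≡ using (_≡_; _≢_; refl; trans; cong)

private
  variable
    n p k : ℕ

IsUniqueIn : Graph n → Colouring n k → (x w : Fin n) → Fin k → Set
IsUniqueIn G χ x w c =
  (w ∈N[ G ] x) × (χ w ≡ just c) × (∀ w′ → w′ ∈N[ G ] x → w′ ≢ w → χ w′ ≢ just c)

ConflictFreeWith : Graph n → Colouring n k → (Fin k → Set) → Set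
ConflictFreeWith G χ P = ∀ x → ∃₂ λ w c → P c × IsUniqueIn G χ x w c

RepeatedIn : Graph n → Colouring n k → Fin n → Fin k → Set
RepeatedIn G χ x c = ∃₂ λ y₁ y₂ →
  (y₁ ∈N[ G ] x) × (y₂ ∈N[ G ] x) × (y₁ ≢ y₂) × (χ y₁ ≡ just c) × (χ y₂ ≡ just c)

NeedsColours : Graph n → ℕ → Set
NeedsColours G k = ∀ m → HasCF G m → k ≤ m

conflictFree⇒uniqueIn : ∀ (G : Graph n) {χ : Colouring n k} →
  ConflictFree G k χ → ∀ x → ∃₂ λ w c → IsUniqueIn G χ x w c
conflictFree⇒uniqueIn G cf x with cf x
... | w , w∈N , c , χw , others = w , c , w∈N , χw , others

conflictFreeWith⇒conflictFree : ∀ (G : Graph n) {χ : Colouring n k} {P} →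
  ConflictFreeWith G χ P → ConflictFree G k χ
conflictFreeWith⇒conflictFree G cf x with cf x
... | w , c , _ , w∈N , χw , others = w , w∈N , c , χw , others

uniqueIn⇒¬repeatedIn : ∀ (G : Graph n) {χ : Colouring n k} {x w c} →
  IsUniqueIn G χ x w c → ¬ RepeatedIn G χ x c
uniqueIn⇒¬repeatedIn G {w = w} (_ , _ , others) (y₁ , y₂ , y₁∈N , y₂∈N , y₁≢y₂ , χy₁ , χy₂)
  with y₁ ≟ w
... | yes refl = others y₂ y₂∈N (y₁≢y₂ ∘ ≡.sym) χy₂
... | no y₁≢w  = others y₁ y₁∈N y₁≢w χy₁

allRepeated⇒¬conflictFree : ∀ (G : Graph n) {χ : Colouring n k} {x} →
  (∀ c → RepeatedIn G χ x c) → ¬ ConflictFree G k χ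
allRepeated⇒¬conflictFree G {x = x} repeated cf with conflictFree⇒uniqueIn G cf x
... | _ , c , unique = uniqueIn⇒¬repeatedIn G unique (repeated c)

uniqueIn-avoidsSharedColour : ∀ (G : Graph n) {χ : Colouring n k} {x y₁ y₂ w c e} →
  y₁ ∈N[ G ] x → y₂ ∈N[ G ] x → y₁ ≢ y₂ → χ y₁ ≡ just c → χ y₂ ≡ just c →
  IsUniqueIn G χ x w e → ¬ (w ≡ y₁ ⊎ w ≡ y₂) × c ≢ e
uniqueIn-avoidsSharedColour G {y₁ = y₁} {y₂} {w} {c} {e} y₁∈N y₂∈N y₁≢y₂ χy₁ χy₂
  unique@(_ , χw , others) = neither , c≢e
  where
  neither : ¬ (w ≡ y₁ ⊎ w ≡ y₂)
  neither (inj₁ refl) = others y₂ y₂∈N (y₁≢y₂ ∘ ≡.sym) (trans χy₂ (trans (≡.sym χy₁) χw))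
  neither (inj₂ refl) = others y₁ y₁∈N y₁≢y₂ (trans χy₁ (trans (≡.sym χy₂) χw))
  c≢e : c ≢ e
  c≢e refl = uniqueIn⇒¬repeatedIn G unique (y₁ , y₂ , y₁∈N , y₂∈N , y₁≢y₂ , χy₁ , χy₂)

deleteColour : Fin (suc k) → Maybe (Fin (suc k)) → Maybe (Fin k)
deleteColour d nothing = nothing
deleteColour d (just e) with d ≟ e
... | yes _   = nothing
... | no d≢e = just (punchOut d≢e)

deleteColour-just : ∀ {d e : Fin (suc k)} (d≢e : d ≢ e) →
  deleteColour d (just e) ≡ just (punchOut d≢e)
deleteColour-just {d = d} {e} d≢e with d ≟ e
... | yes d≡e = ⊥-elim (d≢e d≡e)
... | no _    = cong just (punchOut-cong d refl)

deleteColour-just⁻¹ : ∀ {d e : Fin (suc k)} (d≢e : d ≢ e) x →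
  deleteColour d x ≡ just (punchOut d≢e) → x ≡ just e
deleteColour-just⁻¹ d≢e nothing ()
deleteColour-just⁻¹ {d = d} d≢e (just e′) eq with d ≟ e′
deleteColour-just⁻¹ d≢e (just e′) () | yes _
... | no d≢e′ = cong just (punchOut-injective d≢e′ d≢e (just-injective eq))

deleteColour-conflictFree : ∀ (J : Graph p) {ψ : Colouring p (suc k)} {d} →
  ConflictFreeWith J ψ (d ≢_) → ConflictFree J k (deleteColour d ∘ ψ)
deleteColour-conflictFree J {ψ = ψ} {d} cf a with cf a
... | b , e , d≢e , b∈N , ψb , others =
  b , b∈N , punchOut d≢e , trans (cong (deleteColour d) ψb) (deleteColour-just d≢e) ,
  λ b′ b′∈N b′≢b eq → others b′ b′∈N b′≢b (deleteColour-just⁻¹ d≢e (ψ b′) eq)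

-- Otherwise the unused colour d could be deleted, giving a conflict-free (k−1)-colouring.
everyColourUsed : ∀ (J : Graph p) {ψ : Colouring p k} →
  NeedsColours J k → ConflictFree J k ψ → ∀ d → ∃ λ a → ψ a ≡ just d
everyColourUsed {k = suc k} J {ψ} needs cf d
  with any? (λ a → ≡-decMaybe _≟_ (ψ a) (just d))
... | yes used  = used
... | no unused = ⊥-elim (n≮n k (needs k (_ , deleteColour-conflictFree J avoidsD)))
  where
  avoidsD : ConflictFreeWith J ψ (d ≢_)
  avoidsD a with conflictFree⇒uniqueIn J cf a
  ... | w , e , unique@(_ , ψw , _) = w , e , (λ { refl → unused (w , ψw) }) , unique

everyOtherColourUsed : ∀ (J : Graph p) {ψ : Colouring p (suc k)} {c} →
  NeedsColours J k → ConflictFreeWith J ψ (c ≢_) → ∀ {d} (c≢d : c ≢ d) → ∃ λ a → ψ a ≡ just d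
everyOtherColourUsed J {ψ = ψ} needs cf c≢d
  with everyColourUsed J needs (deleteColour-conflictFree J cf) (punchOut c≢d)
... | a , ψa = a , deleteColour-just⁻¹ c≢d (ψ a) ψa

inducedCopy-∈N : ∀ (G : Graph n) (J : Graph p) {f a b} →
  InducedCopy G J f → b ∈N[ J ] a → f b ∈N[ G ] f a
inducedCopy-∈N G J _         (inj₁ refl) = inj₁ refl
inducedCopy-∈N G J (_ , adj) (inj₂ ab)  = inj₂ (proj₁ (adj _ _) ab)

inducedCopy-uniqueIn : ∀ (G : Graph n) (J : Graph p) {f} {χ : Colouring n k} {a b c} →
  InducedCopy G J f → b ∈N[ J ] a → IsUniqueIn G χ (f a) (f b) c → IsUniqueIn J (χ ∘ f) a b c
inducedCopy-uniqueIn G J {f = f} {b = b} copy@(injective , _) b∈N (_ , χfb , others) =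
  b∈N , χfb , λ b′ b′∈N b′≢b → others (f b′) (inducedCopy-∈N G J copy b′∈N) (b′≢b ∘ injective b′ b)

inducedCopy-∈N⁻¹ : ∀ (G : Graph n) (J : Graph p) {f} {Out : Fin n → Set} {a w} →
  InducedCopy G J f → (∀ a w → Adj G (f a) w → Out w ⊎ ∃ λ b → w ≡ f b) →
  w ∈N[ G ] f a → ¬ Out w → ∃ λ b → w ≡ f b × b ∈N[ J ] a
inducedCopy-∈N⁻¹ G J {a = a} _ _ (inj₁ refl) _ = a , refl , inj₁ refl
inducedCopy-∈N⁻¹ G J {a = a} {w} (_ , adj) closed (inj₂ aw) ¬out with closed a w aw
... | inj₁ out      = ⊥-elim (¬out out)
... | inj₂ (b , refl) = b , refl , inj₂ (proj₂ (adj a b) aw)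

restrict-conflictFree : ∀ (G : Graph n) (J : Graph p) {f : Fin p → Fin n} {χ : Colouring n k}
  {Out : Fin n → Set} {P : Fin k → Set} →
  InducedCopy G J f → (∀ a w → Adj G (f a) w → Out w ⊎ ∃ λ b → w ≡ f b) →
  (∀ {a w c} → IsUniqueIn G χ (f a) w c → ¬ Out w × P c) →
  ConflictFree G k χ → ConflictFreeWith J (χ ∘ f) P
restrict-conflictFree G J {f = f} copy closed avoids cf a with conflictFree⇒uniqueIn G cf (f a)
... | w , c , unique@(w∈N , _) with avoids unique
... | ¬out , Pc with inducedCopy-∈N⁻¹ G J copy closed w∈N ¬out
... | b , refl , b∈N = b , c , Pc , inducedCopy-uniqueIn G J copy b∈N unique

attached-repeatedIn : ∀ (G : Graph n) (J : Graph p) {Inside Out f₁ f₂} {χ : Colouring n k} {x c} →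
  Attached G J Inside Out f₁ f₂ → (∀ {w} → Inside w → Adj G x w) →
  (∃ λ a → χ (f₁ a) ≡ just c) → (∃ λ b → χ (f₂ b) ≡ just c) → RepeatedIn G χ x c
attached-repeatedIn G J {f₁ = f₁} {f₂} (_ , _ , in₁ , in₂ , disjoint , _) inside⇒adj
  (a , χa) (b , χb) =
  f₁ a , f₂ b , inj₂ (inside⇒adj (in₁ a)) , inj₂ (inside⇒adj (in₂ b)) , disjoint a b , χa , χb

attached-centre-coloured : ∀ {m} (G : Graph n) (H : Graph m) {v f₁ f₂} {χ : Colouring n k} →
  NeedsColours H k → Attached G H (Adj G v) (λ w → w ≡ v) f₁ f₂ → ConflictFree G k χ →
  ∃ λ c → χ v ≡ just c
attached-centre-coloured G H {v = v} {χ = χ} needs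
  att@(copy₁ , copy₂ , _ , _ , _ , _ , closed₁ , closed₂) cf with χ v in χv
... | just c  = c , refl
... | nothing = ⊥-elim (allRepeated⇒¬conflictFree G repeated cf)
  where
  avoidsV : ∀ {x w c} → IsUniqueIn G χ x w c → ¬ w ≡ v × ⊤
  avoidsV (_ , χw , _) = (λ { refl → case trans (≡.sym χv) χw of λ () }) , tt
  repeated : ∀ c → RepeatedIn G χ v c
  repeated c = attached-repeatedIn G H att id
    (everyColourUsed H needs
      (conflictFreeWith⇒conflictFree H (restrict-conflictFree G H copy₁ closed₁ avoidsV cf)) c)
    (everyColourUsed H needs
      (conflictFreeWith⇒conflictFree H (restrict-conflictFree G H copy₂ closed₂ avoidsV cf)) c)

attached-ends-differ : ∀ (G : Graph n) (J : Graph p) {u v : Fin n} {h₁ h₂ : Fin p → Fin n}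
  {χ : Colouring n k} {c c′} →
  Adj G u v → NeedsColours J (k ∸ 1) →
  Attached G J (λ w → Adj G u w × Adj G v w) (λ w → w ≡ u ⊎ w ≡ v) h₁ h₂ →
  ConflictFree G k χ → χ u ≡ just c → χ v ≡ just c′ → c ≢ c′
attached-ends-differ {k = zero} _ _ {c = ()}
attached-ends-differ {k = suc _} G J {u = u} {v} {χ = χ} {c} uv needs
  att@(copy₁ , copy₂ , in₁ , in₂ , _ , _ , closed₁ , closed₂) cf χu χv refl =
  allRepeated⇒¬conflictFree G repeated cf
  where
  u≢v : u ≢ v
  u≢v refl = irrefl G u uv
  avoidsUVc : ∀ {x w e} → Adj G u x × Adj G v x → IsUniqueIn G χ x w e →
    ¬ (w ≡ u ⊎ w ≡ v) × c ≢ e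
  avoidsUVc (ux , vx) = uniqueIn-avoidsSharedColour G (inj₂ (sym G ux)) (inj₂ (sym G vx)) u≢v χu χv
  repeated : ∀ d → RepeatedIn G χ v d
  repeated d with c ≟ d
  ... | yes refl = u , v , inj₂ (sym G uv) , inj₁ refl , u≢v , χu , χv
  ... | no c≢d   = attached-repeatedIn G J {Inside = λ w → Adj G u w × Adj G v w} att proj₂
    (everyOtherColourUsed J needs
      (restrict-conflictFree G J copy₁ closed₁ (λ {a} → avoidsUVc (in₁ a)) cf) c≢d)
    (everyOtherColourUsed J needs
      (restrict-conflictFree G J copy₂ closed₂ (λ {a} → avoidsUVc (in₂ a)) cf) c≢d)

lemma1 :
    (∀ (k : ℕ) → 1 ≤ k → ∀ n (G : Graph n) (u v : Fin n) → Adj G u v →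
      ∀ m (H : Graph m) → χCF≡ H k →
      ∀ f₁ f₂ → Attached G H (Adj G v) (λ w → w ≡ v) f₁ f₂ →
      ∀ (χ : Colouring n k) → ConflictFree G k χ →
      Σ (Fin k) λ c → χ v ≡ just c)
    ×
    (∀ (k : ℕ) → 1 ≤ k → ∀ n (G : Graph n) (u v : Fin n) → Adj G u v →
      ∀ m (H : Graph m) → χCF≡ H k →
      ∀ f₁ f₂ → Attached G H (Adj G v) (λ w → w ≡ v) f₁ f₂ →
      ∀ g₁ g₂ → Attached G H (Adj G u) (λ w → w ≡ u) g₁ g₂ →
      ∀ p (J : Graph p) → χCF≡ J (k ∸ 1) →
      ∀ h₁ h₂ → Attached G J (λ w → Adj G u w × Adj G v w) (λ w → (w ≡ u) ⊎ (w ≡ v)) h₁ h₂ →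
      ∀ (χ : Colouring n k) → ConflictFree G k χ →
      Σ (Fin k) λ c → Σ (Fin k) λ c' → (χ u ≡ just c) × (χ v ≡ just c') × (c ≢ c'))
lemma1 =
  (λ _ _ _ G _ _ _ _ H (_ , needsH) _ _ attᵥ _ cf →
    attached-centre-coloured G H needsH attᵥ cf) ,
  λ _ _ _ G _ _ uv _ H (_ , needsH) _ _ attᵥ _ _ attᵤ _ J (_ , needsJ) _ _ attᴶ _ cf →
    let c  , χu = attached-centre-coloured G H needsH attᵤ cf
        c′ , χv = attached-centre-coloured G H needsH attᵥ cf
    in c , c′ , χu , χv , attached-ends-differ G J uv needsJ attᴶ cf χu χv
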